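{- Suppose some algorithm maintains a $\Delta$-orientation for a sequence of $t$ edge updates, starting from the empty graph, while performing $f$ edge flips. Then for any $r\ge0$, the flipping game on this update sequence interleaved with any $r$ reset operations performs at most $t+f+2\Delta r$ edge flips.
   Context: A $\Delta$-orientation is an orientation of all edges with every outdegree at most $\Delta$. Resetting a vertex means flipping all its outgoing edges so they become incoming. The (basic) flipping game maintains an orientation of the current graph: inserted edges are oriented arbitrarily, deleted edges are removed, and each reset operation (applied at an arbitrary vertex at an arbitrary time) resets that vertex, flipping all its outgoing edges. -}

module Defs where

open import Data.Nat using (ℕ; zero; suc; _+_; _≤_)
open import Data.Fin using (Fin; _≟_)
open import Data.Bool using (Bool; true; false; if_then_else_; _∨_; _∧_; not; T)
open import Data.List using (List; []; _∷_; filter; length; allFin)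
open import Data.Product using (_×_)
open import Relation.Nullary using (¬_)
open import Relation.Nullary.Decidable using (⌊_⌋)
open import Relation.Binary.PropositionalEquality using (_≡_; _≢_)

-- A (partial) orientation of a simple graph on vertex set Fin n:
-- O u v ≡ true means the edge {u,v} is present and oriented u → v.
-- The underlying graph is the symmetric closure (O u v ∨ O v u).
Orientation : ℕ → Set
Orientation n = Fin n → Fin n → Bool

emptyO : ∀ {n} → Orientation n
emptyO _ _ = false

_==_ : ∀ {n} → Fin n → Fin n → Bool
x == y = ⌊ x ≟ y ⌋

outdeg : ∀ {n} → Orientation n → Fin n → ℕ
outdeg {n} O v = length (filter (λ y → T? (O v y)) (allFin n))
  where
  open import Data.Bool using (T?)

IsΔOrientation : ∀ {n} → ℕ → Orientation n → Set
IsΔOrientation {n} Δ O = (v : Fin n) → outdeg O v ≤ Δ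

data Update (n : ℕ) : Set where
  insert : Fin n → Fin n → Update n
  delete : Fin n → Fin n → Update n

Valid : ∀ {n} → Update n → Orientation n → Set
Valid (insert u v) O = (u ≢ v) × (O u v ≡ false) × (O v u ≡ false)
Valid (delete u v) O = T (O u v ∨ O v u)

-- Apply an update; the Bool chooses the orientation of an inserted edge
-- (true: u → v, false: v → u); it is ignored for deletions.
apply : ∀ {n} → Update n → Bool → Orientation n → Orientation n
apply (insert u v) true  O x y = (x == u ∧ y == v) ∨ O x y
apply (insert u v) false O x y = (x == v ∧ y == u) ∨ O x y
apply (delete u v) _     O x y = not ((x == u ∧ y == v) ∨ (x == v ∧ y == u)) ∧ O x y

flip : ∀ {n} → Orientation n → Fin n → Fin n → Orientation n
flip O u v x y =
  if (x == u ∧ y == v) then false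
  else if (x == v ∧ y == u) then true
  else O x y

reset : ∀ {n} → Orientation n → Fin n → Orientation n
reset O v x y =
  if x == v then false
  else if y == v then (O x v ∨ O v x)
  else O x y

-- After each update the algorithm may perform any number of flips; the
-- orientation must be a Δ-orientation once it has finished processing an
-- update (i.e. just before the next update, and at the end).
data AlgRun {n : ℕ} (Δ : ℕ) : Orientation n → List (Update n) → ℕ → Set where
  done : ∀ {O} → IsΔOrientation Δ O → AlgRun Δ O [] 0
  flipStep : ∀ {O us f} (u v : Fin n) → O u v ≡ true →
             AlgRun Δ (flip O u v) us f → AlgRun Δ O us (suc f)
  updStep : ∀ {O us f} (up : Update n) → IsΔOrientation Δ O → Valid up O →
            (b : Bool) → AlgRun Δ (apply up b O) us f → AlgRun Δ O (up ∷ us) f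

data GameRun {n : ℕ} : Orientation n → List (Update n) → ℕ → ℕ → Set where
  done : ∀ {O} → GameRun O [] 0 0
  resetStep : ∀ {O us r g} (v : Fin n) →
              GameRun (reset O v) us r g → GameRun O us (suc r) (outdeg O v + g)
  updStep : ∀ {O us r g} (up : Update n) → Valid up O →
            (b : Bool) → GameRun (apply up b O) us r g → GameRun O (up ∷ us) r g

module Submission where

-- Run the algorithm (orientation A) and the game (orientation G) side by side
-- on the same update sequence.  Both orient the same loopless graph, and the
-- potential Φ(A,G) counts the arcs of G that point against A.  Then
--   * an update or a flip of the algorithm raises Φ by at most 1;
--   * a reset of v costs outdeg_G(v) flips, and turns the out-arcs of v that
--     agree with A into disagreeing ones while repairing all disagreeing
--     out-arcs, so  cost + ΔΦ ≤ 2·outdeg_A(v) ≤ 2Δ.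
-- Summing over the run (Φ starts at 0 and stays ≥ 0) gives  g ≤ t + f + 2Δr
-- with t the number of updates.

open import Defs
open import Function using (_∘_)
open import Data.Nat using (ℕ; zero; suc; _+_; _*_; _≤_; z≤n)
open import Data.Nat.Properties
  using ( +-0-commutativeMonoid; +-identityʳ; +-assoc; +-mono-≤; +-monoʳ-≤; +-monoˡ-≤
        ; *-monoʳ-≤; *-cancelˡ-≤; ≤-refl; ≤-trans; ≤-reflexive
        ; +-comm; m≤m+n; m≤n+m; ≤ᵇ⇒≤; module ≤-Reasoning)
open import Data.Unit using (tt)
open import Data.Nat.Tactic.RingSolver using (solve-∀)
open import Data.Fin using (Fin; zero; suc; _≟_)
open import Data.Bool using (Bool; true; false; if_then_else_; _∨_; _∧_; not; T?)
open import Data.Bool.Properties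
  using (∨-comm; ∧-comm; ∨-zeroʳ; ∨-identityʳ; ∧-zeroʳ; ∧-distribˡ-∨; ∨-commutativeMonoid)
open import Data.List using (List; _∷_; filter; length; tabulate)
open import Data.Product using (_×_; _,_)
open import Relation.Unary using (Pred; Decidable)
open import Relation.Nullary using (does; yes; no; contradiction)
open import Relation.Binary.PropositionalEquality
open import Algebra.Bundles using (CommutativeMonoid)
open import Algebra.Properties.CommutativeSemigroup
  (CommutativeMonoid.commutativeSemigroup ∨-commutativeMonoid) using (interchange)
open import Algebra.Properties.CommutativeMonoid.Sum +-0-commutativeMonoid
  using (sum; sum-syntax; sum-cong-≗; sum-replicate-zero; ∑-distrib-+; ∑-comm)

ind : Bool → ℕ
ind b = if b then 1 else 0

ind≤1 : ∀ b → ind b ≤ 1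
ind≤1 true  = ≤-refl
ind≤1 false = z≤n

∑-mono : ∀ {n} {f g : Fin n → ℕ} → (∀ i → f i ≤ g i) → sum f ≤ sum g
∑-mono {zero}  _   = z≤n
∑-mono {suc n} f≤g = +-mono-≤ (f≤g zero) (∑-mono (f≤g ∘ suc))

==-refl : ∀ {n} (x : Fin n) → x == x ≡ true
==-refl x with x ≟ x
... | yes _   = refl
... | no x≢x = contradiction refl x≢x

==-true : ∀ {n} {x y : Fin n} → x == y ≡ true → x ≡ y
==-true {x = x} {y} x==y with x ≟ y
... | yes x≡y = x≡y

==-false : ∀ {n} {x y : Fin n} → x ≢ y → x == y ≡ false
==-false {x = x} {y} x≢y with x ≟ y
... | yes x≡y = contradiction x≡y x≢y
... | no _    = refl

==-suc : ∀ {n} (x y : Fin n) → (suc x == suc y) ≡ (x == y)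
==-suc x y with x ≟ y
... | yes _ = refl
... | no _  = refl

arc : ∀ {n} → Fin n → Fin n → Fin n → Fin n → Bool
arc a c x y = x == a ∧ y == c

∑-at : ∀ {n} (v : Fin n) (h : Fin n → ℕ) → ∑[ x < n ] (if x == v then h x else 0) ≡ h v
∑-at {suc n} zero    h = trans (cong (h zero +_) (sum-replicate-zero n)) (+-identityʳ (h zero))
∑-at {suc n} (suc v) h = begin
  ∑[ x < n ] (if suc x == suc v then h (suc x) else 0) ≡⟨ sum-cong-≗ (λ x → cong (λ b → if b then h (suc x) else 0) (==-suc x v)) ⟩
  ∑[ x < n ] (if x == v then h (suc x) else 0)         ≡⟨ ∑-at v (h ∘ suc) ⟩
  h (suc v)                                            ∎
  where open ≡-Reasoning

∑∑ : ∀ {n} → (Fin n → Fin n → ℕ) → ℕ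
∑∑ {n} F = ∑[ x < n ] ∑[ y < n ] F x y

∑∑-mono : ∀ {n} {F G : Fin n → Fin n → ℕ} → (∀ x y → F x y ≤ G x y) → ∑∑ F ≤ ∑∑ G
∑∑-mono F≤G = ∑-mono (λ x → ∑-mono (F≤G x))

∑∑-distrib-+ : ∀ {n} (F G : Fin n → Fin n → ℕ) → ∑∑ (λ x y → F x y + G x y) ≡ ∑∑ F + ∑∑ G
∑∑-distrib-+ {n} F G =
  trans (sum-cong-≗ (λ x → ∑-distrib-+ (F x) (G x))) (∑-distrib-+ (λ x → ∑[ y < n ] F x y) (λ x → ∑[ y < n ] G x y))

∑∑-row : ∀ {n} (a : Fin n) (R : Fin n → Fin n → Bool) →
         ∑∑ (λ x y → ind (x == a ∧ R x y)) ≡ ∑[ y < n ] ind (R a y)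
∑∑-row {n} a R = trans (sum-cong-≗ row) (∑-at a (λ x → ∑[ y < n ] ind (R x y)))
  where
  row : ∀ x → ∑[ y < n ] ind (x == a ∧ R x y) ≡ (if x == a then ∑[ y < n ] ind (R x y) else 0)
  row x with x == a
  ... | true  = refl
  ... | false = sum-replicate-zero n

∑∑-arc : ∀ {n} (a c : Fin n) → ∑∑ (λ x y → ind (arc a c x y)) ≡ 1
∑∑-arc a c = trans (∑∑-row a (λ _ y → y == c)) (∑-at c (λ _ → 1))

∑∑-bump : ∀ {n} (a c : Fin n) {F F' : Fin n → Fin n → ℕ} →
          (∀ x y → F' x y ≤ F x y + ind (arc a c x y)) → ∑∑ F' ≤ ∑∑ F + 1
∑∑-bump a c {F} F'≤F+δ = ≤-trans (∑∑-mono F'≤F+δ)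
  (≤-reflexive (trans (∑∑-distrib-+ F _) (cong (∑∑ F +_) (∑∑-arc a c))))

-- Symmetrised comparison: every pair of opposite entries of F is dominated
-- by the corresponding pair of G, hence so is the total.  (Each unordered
-- pair is counted twice on both sides, so the factor 2 cancels.)
∑∑-sym-mono : ∀ {n} {F G : Fin n → Fin n → ℕ} →
              (∀ x y → F x y + F y x ≤ G x y + G y x) → ∑∑ F ≤ ∑∑ G
∑∑-sym-mono {n} {F} {G} pair≤ = *-cancelˡ-≤ 2 (begin
  2 * ∑∑ F                            ≡⟨ twice F ⟩
  ∑∑ (λ x y → F x y + F y x)           ≤⟨ ∑∑-mono pair≤ ⟩
  ∑∑ (λ x y → G x y + G y x)           ≡⟨ twice G ⟨
  2 * ∑∑ G                            ∎)
  where
  open ≤-Reasoning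
  twice : ∀ H → 2 * ∑∑ H ≡ ∑∑ (λ x y → H x y + H y x)
  twice H = begin-equality
    ∑∑ H + (∑∑ H + 0)                   ≡⟨ cong (∑∑ H +_) (+-identityʳ (∑∑ H)) ⟩
    ∑∑ H + ∑∑ H                         ≡⟨ cong (∑∑ H +_) (∑-comm H) ⟩
    ∑∑ H + ∑∑ (λ x y → H y x)           ≡⟨ ∑∑-distrib-+ H _ ⟨
    ∑∑ (λ x y → H x y + H y x)           ∎

length-filter-tabulate : ∀ {a p} {A : Set a} {P : Pred A p} (P? : Decidable P) {n} (g : Fin n → A) →
                         length (filter P? (tabulate g)) ≡ ∑[ i < n ] ind (does (P? (g i)))
length-filter-tabulate P? {zero}  g = refl
length-filter-tabulate P? {suc n} g with does (P? (g zero))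
... | true  = cong suc (length-filter-tabulate P? (g ∘ suc))
... | false = length-filter-tabulate P? (g ∘ suc)

outArc : ∀ {n} → Orientation n → Fin n → Fin n → Fin n → ℕ
outArc O v x y = ind (x == v ∧ O x y)

outdeg-∑∑ : ∀ {n} (O : Orientation n) (v : Fin n) → outdeg O v ≡ ∑∑ (outArc O v)
outdeg-∑∑ O v = trans (length-filter-tabulate (T? ∘ O v) (λ y → y)) (sym (∑∑-row v O))

edge : ∀ {n} → Orientation n → Fin n → Fin n → Bool
edge O x y = O x y ∨ O y x

Loopless : ∀ {n} → Orientation n → Set
Loopless O = ∀ x → O x x ≡ false

record Coupled {n} (A G : Orientation n) : Set where
  field
    loopless-A : Loopless A
    loopless-G : Loopless G
    same-graph : ∀ x y → edge G x y ≡ edge A x y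

open Coupled

link : ∀ {n} → Fin n → Fin n → Fin n → Fin n → Bool
link u v x y = arc u v x y ∨ arc v u x y

arc-transpose : ∀ {n} (a c x y : Fin n) → arc a c y x ≡ arc c a x y
arc-transpose a c x y = ∧-comm (y == a) (x == c)

arc-true : ∀ {n} {a c x y : Fin n} → arc a c x y ≡ true → x ≡ a × y ≡ c
arc-true {a = a} {c} {x} {y} _ with x == a in x==a | y == c in y==c
arc-true _  | true  | true  = ==-true x==a , ==-true y==c
arc-true () | true  | false
arc-true () | false | _

arc-diagonal : ∀ {n} {a c : Fin n} → a ≢ c → ∀ x → arc a c x x ≡ false
arc-diagonal {a = a} {c} a≢c x with x == a in x==a
... | false = refl
... | true with refl ← ==-true x==a = ==-false a≢c

link-transpose : ∀ {n} (u v x y : Fin n) → link u v y x ≡ link u v x y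
link-transpose u v x y = begin
  arc u v y x ∨ arc v u y x ≡⟨ cong₂ _∨_ (arc-transpose u v x y) (arc-transpose v u x y) ⟩
  arc v u x y ∨ arc u v x y ≡⟨ ∨-comm (arc v u x y) (arc u v x y) ⟩
  link u v x y              ∎
  where open ≡-Reasoning

updateGraph : ∀ {n} → Update n → Fin n → Fin n → Bool → Bool
updateGraph (insert u v) x y e = link u v x y ∨ e
updateGraph (delete u v) x y e = not (link u v x y) ∧ e

edge-add-arc : ∀ {n} (a c : Fin n) (O : Orientation n) x y →
               edge (λ x y → arc a c x y ∨ O x y) x y ≡ link a c x y ∨ edge O x y
edge-add-arc a c O x y = begin
  (arc a c x y ∨ O x y) ∨ (arc a c y x ∨ O y x) ≡⟨ interchange (arc a c x y) (O x y) (arc a c y x) (O y x) ⟩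
  (arc a c x y ∨ arc a c y x) ∨ edge O x y      ≡⟨ cong (λ e → (arc a c x y ∨ e) ∨ edge O x y) (arc-transpose a c x y) ⟩
  link a c x y ∨ edge O x y                     ∎
  where open ≡-Reasoning

edge-apply : ∀ {n} (up : Update n) b (O : Orientation n) x y →
             edge (apply up b O) x y ≡ updateGraph up x y (edge O x y)
edge-apply (insert u v) true  O x y = edge-add-arc u v O x y
edge-apply (insert u v) false O x y =
  trans (edge-add-arc v u O x y) (cong (_∨ edge O x y) (∨-comm (arc v u x y) (arc u v x y)))
edge-apply (delete u v) _     O x y = begin
  (not (link u v x y) ∧ O x y) ∨ (not (link u v y x) ∧ O y x) ≡⟨ cong (λ l → (not (link u v x y) ∧ O x y) ∨ (not l ∧ O y x)) (link-transpose u v x y) ⟩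
  (not (link u v x y) ∧ O x y) ∨ (not (link u v x y) ∧ O y x) ≡⟨ ∧-distribˡ-∨ (not (link u v x y)) (O x y) (O y x) ⟨
  not (link u v x y) ∧ edge O x y                               ∎
  where open ≡-Reasoning

flip-transpose : ∀ {n} (A : Orientation n) u v x y →
                 flip A u v y x ≡ (if arc v u x y then false else if arc u v x y then true else A y x)
flip-transpose A u v x y =
  cong₂ (λ p q → if p then false else if q then true else A y x) (arc-transpose u v x y) (arc-transpose v u x y)

-- Flipping an existing arc keeps the underlying graph; the pair (x , y)
-- cannot lie on both u → v and v → u, since that would make u → u a loop.
edge-flip : ∀ {n} {A : Orientation n} {u v} → Loopless A → A u v ≡ true →
            ∀ x y → edge (flip A u v) x y ≡ edge A x y
edge-flip {A = A} {u} {v} loopless Auv x y rewrite flip-transpose A u v x y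
  with arc u v x y in uv | arc v u x y in vu
... | true  | true  with refl , refl ← arc-true {a = u} {v} {x} {y} uv | refl , _ ← arc-true {a = v} {u} {x} {y} vu =
  contradiction (trans (sym Auv) (loopless x)) λ ()
... | true  | false with refl , refl ← arc-true {a = u} {v} {x} {y} uv = sym (cong (_∨ A v u) Auv)
... | false | true  with refl , refl ← arc-true {a = v} {u} {x} {y} vu = sym (trans (cong (A v u ∨_) Auv) (∨-zeroʳ (A v u)))
... | false | false = refl

edge-reset : ∀ {n} {G : Orientation n} → Loopless G → ∀ v x y → edge (reset G v) x y ≡ edge G x y
edge-reset {G = G} loopless v x y with x == v in x==v | y == v in y==v
... | true  | true  with refl ← ==-true x==v | refl ← ==-true y==v rewrite loopless x = refl
... | true  | false with refl ← ==-true x==v = ∨-comm (G y x) (G x y)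
... | false | true  with refl ← ==-true y==v = ∨-identityʳ (G x y ∨ G y x)
... | false | false = refl

loopless-flip : ∀ {n} {A : Orientation n} {u v} → Loopless A → Loopless (flip A u v)
loopless-flip {u = u} {v} loopless x with arc u v x x in uv
... | true  = refl
... | false rewrite ∧-comm (x == v) (x == u) | uv = loopless x

loopless-apply : ∀ {n} {O : Orientation n} (up : Update n) b → Valid up O → Loopless O → Loopless (apply up b O)
loopless-apply (insert u v) true  (u≢v , _) loopless x rewrite arc-diagonal u≢v x = loopless x
loopless-apply (insert u v) false (u≢v , _) loopless x rewrite arc-diagonal (u≢v ∘ sym) x = loopless x
loopless-apply (delete u v) _ _ loopless x rewrite loopless x = ∧-zeroʳ (not (link u v x x))

loopless-reset : ∀ {n} {G : Orientation n} v → Loopless G → Loopless (reset G v)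
loopless-reset v loopless x with x == v
... | true  = refl
... | false = loopless x

coupled-flip : ∀ {n} {A G : Orientation n} {u v} → Coupled A G → A u v ≡ true → Coupled (flip A u v) G
coupled-flip {A = A} c Auv = record
  { loopless-A = loopless-flip {A = A} (loopless-A c)
  ; loopless-G = loopless-G c
  ; same-graph = λ x y → trans (same-graph c x y) (sym (edge-flip (loopless-A c) Auv x y))
  }

coupled-apply : ∀ {n} {A G : Orientation n} (up : Update n) b b' → Valid up A → Valid up G →
                Coupled A G → Coupled (apply up b A) (apply up b' G)
coupled-apply {A = A} {G} up b b' validA validG c = record
  { loopless-A = loopless-apply up b validA (loopless-A c)
  ; loopless-G = loopless-apply up b' validG (loopless-G c)
  ; same-graph = λ x y → begin
      edge (apply up b' G) x y      ≡⟨ edge-apply up b' G x y ⟩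
      updateGraph up x y (edge G x y) ≡⟨ cong (updateGraph up x y) (same-graph c x y) ⟩
      updateGraph up x y (edge A x y) ≡⟨ edge-apply up b A x y ⟨
      edge (apply up b A) x y      ∎
  }
  where open ≡-Reasoning

coupled-reset : ∀ {n} {A G : Orientation n} v → Coupled A G → Coupled A (reset G v)
coupled-reset {G = G} v c = record
  { loopless-A = loopless-A c
  ; loopless-G = loopless-reset {G = G} v (loopless-G c)
  ; same-graph = λ x y → trans (edge-reset (loopless-G c) v x y) (same-graph c x y)
  }

disagree : ∀ {n} → Orientation n → Orientation n → Fin n → Fin n → ℕ
disagree A G x y = ind (G x y ∧ not (A x y))

Φ : ∀ {n} → Orientation n → Orientation n → ℕ
Φ A G = ∑∑ (disagree A G)

Φ-empty : ∀ {n} → Φ (emptyO {n}) emptyO ≡ 0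
Φ-empty {n} = trans (sum-cong-≗ {n = n} (λ _ → sum-replicate-zero n)) (sum-replicate-zero n)

-- Pointwise effect of the operations on one pair; an entry can only grow,
-- by one, at the pair marked p.  Flip: the algorithm's arc p = (u→v) is
-- replaced by q = (v→u).
flip-disagree : ∀ p q g a → ind (g ∧ not (if p then false else if q then true else a)) ≤ ind (g ∧ not a) + ind p
flip-disagree _     _     false _ = z≤n
flip-disagree true  _     true  a = m≤n+m 1 (ind (not a))
flip-disagree false true  true  _ = z≤n
flip-disagree false false true  a = m≤m+n (ind (not a)) 0

-- Insertion: the game gains arc p, the algorithm gains arc q.
insert-disagree : ∀ p g q a → ind ((p ∨ g) ∧ not (q ∨ a)) ≤ ind (g ∧ not a) + ind p
insert-disagree true  g     q     a = ≤-trans (ind≤1 (not (q ∨ a))) (m≤n+m 1 (ind (g ∧ not a)))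
insert-disagree false false _     _ = z≤n
insert-disagree false true  true  _ = z≤n
insert-disagree false true  false a = m≤m+n (ind (not a)) 0

delete-disagree : ∀ e g a → ind ((not e ∧ g) ∧ not (not e ∧ a)) ≤ ind (g ∧ not a)
delete-disagree true  _ _ = z≤n
delete-disagree false g a = ≤-refl

Φ-flip : ∀ {n} (A G : Orientation n) u v → Φ (flip A u v) G ≤ Φ A G + 1
Φ-flip A G u v = ∑∑-bump u v (λ x y → flip-disagree (arc u v x y) (arc v u x y) (G x y) (A x y))

Φ-apply : ∀ {n} (A G : Orientation n) up b b' → Φ (apply up b A) (apply up b' G) ≤ Φ A G + 1
Φ-apply A G (insert u v) true  true  = ∑∑-bump u v (λ x y → insert-disagree (arc u v x y) (G x y) (arc u v x y) (A x y))
Φ-apply A G (insert u v) false true  = ∑∑-bump u v (λ x y → insert-disagree (arc u v x y) (G x y) (arc v u x y) (A x y))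
Φ-apply A G (insert u v) true  false = ∑∑-bump v u (λ x y → insert-disagree (arc v u x y) (G x y) (arc u v x y) (A x y))
Φ-apply A G (insert u v) false false = ∑∑-bump v u (λ x y → insert-disagree (arc v u x y) (G x y) (arc v u x y) (A x y))
Φ-apply A G (delete u v) _     _     =
  ≤-trans (∑∑-mono (λ x y → delete-disagree (link u v x y) (G x y) (A x y))) (m≤m+n (Φ A G) 1)

-- Truth table for one edge {v , y}, y ≠ v, with game arcs a = (v→y),
-- b = (y→v) and algorithm arcs c = (v→y), d = (y→v) on the same edge:
-- the flip cost of a plus the new disagreement on y→v is paid for by the
-- old disagreements plus twice the algorithm's out-arc c.
reset-edge-bound : ∀ a b c d → a ∨ b ≡ c ∨ d →
  ind a + 0 + ind ((b ∨ a) ∧ not d) ≤ ind (a ∧ not c) + (ind c + ind c) + (ind (b ∧ not d) + 0)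
reset-edge-bound false false false false _  = z≤n
reset-edge-bound false false true  _     ()
reset-edge-bound false false false true  ()
reset-edge-bound true  _     false false ()
reset-edge-bound false true  false false ()
reset-edge-bound true  true  true  true  _  = ≤ᵇ⇒≤ _ _ tt
reset-edge-bound true  true  true  false _  = ≤ᵇ⇒≤ _ _ tt
reset-edge-bound true  true  false true  _  = ≤ᵇ⇒≤ _ _ tt
reset-edge-bound true  false true  true  _  = ≤ᵇ⇒≤ _ _ tt
reset-edge-bound true  false true  false _  = ≤ᵇ⇒≤ _ _ tt
reset-edge-bound true  false false true  _  = ≤ᵇ⇒≤ _ _ tt
reset-edge-bound false true  true  true  _  = ≤ᵇ⇒≤ _ _ tt
reset-edge-bound false true  true  false _  = ≤ᵇ⇒≤ _ _ tt
reset-edge-bound false true  false true  _  = ≤ᵇ⇒≤ _ _ tt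

reset-edge-bound-transposed : ∀ a b c d → a ∨ b ≡ c ∨ d →
  ind ((b ∨ a) ∧ not d) + (ind a + 0) ≤ ind (b ∧ not d) + 0 + (ind (a ∧ not c) + (ind c + ind c))
reset-edge-bound-transposed a b c d same =
  subst₂ _≤_ (+-comm (ind a + 0) _) (+-comm (ind (a ∧ not c) + (ind c + ind c)) _) (reset-edge-bound a b c d same)

module _ {n} {A G : Orientation n} (coupled : Coupled A G) (v : Fin n) where

  -- Per pair: the flip of x → y (if x = v) plus the disagreement after the reset ...
  resetCost : Fin n → Fin n → ℕ
  resetCost x y = outArc G v x y + disagree A (reset G v) x y

  -- ... is covered, up to transposition, by the disagreement before the
  -- reset plus twice the algorithm's arcs out of v.
  resetBudget : Fin n → Fin n → ℕ
  resetBudget x y = disagree A G x y + (outArc A v x y + outArc A v x y)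

  -- Only the two arcs of an edge {v , y} need the truth table.
  reset-pair : ∀ x y → resetCost x y + resetCost y x ≤ resetBudget x y + resetBudget y x
  reset-pair x y with x ≟ v | y ≟ v
  ... | yes refl | yes refl rewrite loopless-G coupled x | loopless-A coupled x = z≤n
  ... | yes refl | no _     = reset-edge-bound (G x y) (G y x) (A x y) (A y x) (same-graph coupled x y)
  ... | no _     | yes refl = reset-edge-bound-transposed (G y x) (G x y) (A y x) (A x y) (same-graph coupled y x)
  ... | no _     | no _     = +-mono-≤ (m≤m+n (disagree A G x y) 0) (m≤m+n (disagree A G y x) 0)

  reset-bound : outdeg G v + Φ A (reset G v) ≤ Φ A G + 2 * outdeg A v
  reset-bound = begin
    outdeg G v + Φ A (reset G v)                         ≡⟨ cong (_+ Φ A (reset G v)) (outdeg-∑∑ G v) ⟩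
    ∑∑ (outArc G v) + Φ A (reset G v)                    ≡⟨ ∑∑-distrib-+ (outArc G v) (disagree A (reset G v)) ⟨
    ∑∑ resetCost                                         ≤⟨ ∑∑-sym-mono reset-pair ⟩
    ∑∑ resetBudget                                       ≡⟨ ∑∑-distrib-+ (disagree A G) _ ⟩
    Φ A G + ∑∑ (λ x y → outArc A v x y + outArc A v x y) ≡⟨ cong (Φ A G +_) (∑∑-distrib-+ (outArc A v) (outArc A v)) ⟩
    Φ A G + (∑∑ (outArc A v) + ∑∑ (outArc A v))          ≡⟨ cong (λ d → Φ A G + (d + d)) (outdeg-∑∑ A v) ⟨
    Φ A G + (outdeg A v + outdeg A v)                    ≡⟨ cong (λ d → Φ A G + (outdeg A v + d)) (+-identityʳ (outdeg A v)) ⟨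
    Φ A G + 2 * outdeg A v                               ∎
    where open ≤-Reasoning

coupled-empty : ∀ {n} → Coupled (emptyO {n}) emptyO
coupled-empty = record { loopless-A = λ _ → refl ; loopless-G = λ _ → refl ; same-graph = λ _ _ → refl }

-- A game reset happens while the algorithm is between updates, hence at a
-- Δ-orientation: its cost is absorbed by the budget 2Δ of one reset.
reset-step : ∀ {n} Δ {A G : Orientation n} v {t r g} → IsΔOrientation Δ A → Coupled A G →
             g ≤ Φ A (reset G v) + (t + 2 * Δ * r) →
             outdeg G v + g ≤ Φ A G + (t + 2 * Δ * suc r)
reset-step Δ {A} {G} v {t} {r} {g} isΔ c g≤ = begin
  outdeg G v + g                                    ≤⟨ +-monoʳ-≤ (outdeg G v) g≤ ⟩
  outdeg G v + (Φ A (reset G v) + (t + 2 * Δ * r))  ≡⟨ +-assoc (outdeg G v) _ _ ⟨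
  outdeg G v + Φ A (reset G v) + (t + 2 * Δ * r)    ≤⟨ +-monoˡ-≤ _ (reset-bound c v) ⟩
  Φ A G + 2 * outdeg A v + (t + 2 * Δ * r)          ≤⟨ +-monoˡ-≤ _ (+-monoʳ-≤ (Φ A G) (*-monoʳ-≤ 2 (isΔ v))) ⟩
  Φ A G + 2 * Δ + (t + 2 * Δ * r)                   ≡⟨ regroup (Φ A G) Δ t r ⟩
  Φ A G + (t + 2 * Δ * suc r)                       ∎
  where
  open ≤-Reasoning
  regroup : ∀ p d t r → p + 2 * d + (t + 2 * d * r) ≡ p + (t + 2 * d * suc r)
  regroup = solve-∀

amortised : ∀ {n} Δ {A G : Orientation n} {us f r g} →
            AlgRun Δ A us f → GameRun G us r g → Coupled A G →
            g ≤ Φ A G + (length us + f + 2 * Δ * r)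
amortised Δ {A} {G} {us} {suc f} {r} {g} (flipStep u v Auv alg) game c = begin
  g                                              ≤⟨ amortised Δ alg game (coupled-flip c Auv) ⟩
  Φ (flip A u v) G + (length us + f + 2 * Δ * r) ≤⟨ +-monoˡ-≤ _ (Φ-flip A G u v) ⟩
  Φ A G + 1 + (length us + f + 2 * Δ * r)        ≡⟨ regroup (Φ A G) (length us) f (2 * Δ * r) ⟩
  Φ A G + (length us + suc f + 2 * Δ * r)        ∎
  where
  open ≤-Reasoning
  regroup : ∀ p l f x → p + 1 + (l + f + x) ≡ p + (l + suc f + x)
  regroup = solve-∀
amortised Δ (done _) done _ = z≤n
amortised Δ alg@(done isΔ) (resetStep v game) c =
  reset-step Δ v isΔ c (amortised Δ alg game (coupled-reset v c))
amortised Δ alg@(updStep _ isΔ _ _ _) (resetStep v game) c =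
  reset-step Δ v isΔ c (amortised Δ alg game (coupled-reset v c))
amortised Δ {A} {G} {up ∷ us} {f} {r} {g} (updStep up _ validA b alg) (updStep .up validG b' game) c = begin
  g                                                              ≤⟨ amortised Δ alg game (coupled-apply up b b' validA validG c) ⟩
  Φ (apply up b A) (apply up b' G) + (length us + f + 2 * Δ * r) ≤⟨ +-monoˡ-≤ _ (Φ-apply A G up b b') ⟩
  Φ A G + 1 + (length us + f + 2 * Δ * r)                        ≡⟨ +-assoc (Φ A G) 1 _ ⟩
  Φ A G + (length (up ∷ us) + f + 2 * Δ * r)                     ∎
  where open ≤-Reasoning

lemma9 : (n Δ : ℕ) (us : List (Update n)) (f r g : ℕ) →
         AlgRun Δ (emptyO {n}) us f →
         GameRun (emptyO {n}) us r g →
         g ≤ length us + f + 2 * Δ * r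
lemma9 n Δ us f r g alg game =
  subst (λ p → g ≤ p + (length us + f + 2 * Δ * r)) (Φ-empty {n}) (amortised Δ alg game coupled-empty)
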